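{- Let $A_1,A_2\subseteq\mathbb{N}_{+}$ with $A_1\cap A_2=\emptyset$. Suppose that for $i=1,2$ and all $k,n\in\mathbb{N}$ we have $(-1)^{n}S_{A_i,k}(n)\geq 0$. Then $(-1)^{n}S_{A_1\cup A_2,k}(n)\geq0$ for all $k,n\in\mathbb{N}$.
   Context: For $A\subseteq\mathbb{N}_{+}$, $c_A(i,n)$ denotes the number of partitions of $n\in\mathbb{N}$ into exactly $i$ parts, all lying in $A$ (order of parts disregarded; $c_A(0,0)=1$), and for $k\in\mathbb{N}$, $S_{A,k}(n)=\sum_{i=0}^{n}(-1)^{i}i^{k}c_A(i,n)$ (with the convention $0^0=1$). -}

module Defs where

open import Data.Nat using (ℕ; zero; suc; _+_; _*_; _∸_; _^_; _≤ᵇ_)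
open import Data.Bool using (Bool; true; false; _∧_; _∨_; if_then_else_)
open import Data.Integer as ℤ using (ℤ; +_)

-- A subset of ℕ₊ is represented by its characteristic function ℕ → Bool;
-- the value at 0 is irrelevant (parts are always ≥ 1).
Subset : Set
Subset = ℕ → Bool

_∪_ : Subset → Subset → Subset
(A ∪ B) x = A x ∨ B x

Disjoint : Subset → Subset → Set
Disjoint A B = ∀ x → A (suc x) ∧ B (suc x) ≡ false
  where open import Relation.Binary.PropositionalEquality using (_≡_)

sumTo : ℕ → (ℕ → ℕ) → ℕ
sumTo zero    f = f 0
sumTo (suc n) f = sumTo n f + f (suc n)

sumToℤ : ℕ → (ℕ → ℤ) → ℤ
sumToℤ zero    f = f 0
sumToℤ (suc n) f = sumToℤ n f ℤ.+ f (suc n)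

isZero : ℕ → Bool
isZero zero    = true
isZero (suc _) = false

bit : Bool → ℕ
bit true  = 1
bit false = 0

-- parts A i n m = number of partitions of n into exactly i parts, all lying
-- in A and all in {1,…,m}.  Counted via the multiplicity j of the part m+1:
-- parts A i n (m+1) = Σ_{j} [j=0 or m+1 ∈ A] · parts A (i-j) (n-j(m+1)) m,
-- over j ≤ i with j(m+1) ≤ n.
parts : Subset → ℕ → ℕ → ℕ → ℕ
parts A i n zero    = bit (isZero i ∧ isZero n)
parts A i n (suc m) =
  sumTo i (λ j → bit ((isZero j ∨ A (suc m)) ∧ (j * suc m ≤ᵇ n))
                 * parts A (i ∸ j) (n ∸ j * suc m) m)

c : Subset → ℕ → ℕ → ℕ
c A i n = parts A i n n

sgn : ℕ → ℤ
sgn zero    = + 1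
sgn (suc i) = ℤ.- sgn i

-- S_{A,k}(n) = Σ_{i=0}^{n} (-1)^i i^k c_A(i,n)   (0^0 = 1, as for ℕ's _^_)
S : Subset → ℕ → ℕ → ℤ
S A k n = sumToℤ n (λ i → sgn i ℤ.* (+ (i ^ k * c A i n)))

-- The generating function Σ c_A(i,n) xⁱ qⁿ is the product of 1/(1 − x qᵃ) over a ∈ A, so for disjoint A₁, A₂
-- the coefficients c_{A₁∪A₂} are the two-variable convolution of c_{A₁} and c_{A₂}. Writing i = i₁ + i₂,
-- (−1)ⁱ = (−1)^i₁ (−1)^i₂ and expanding iᵏ = (i₁ + i₂)ᵏ into its 2ᵏ monomials i₁ᵃ i₂ᵇ gives
--   S_{A₁∪A₂,k}(n) = Σ_{n₁+n₂=n} Σ_{a,b} S_{A₁,a}(n₁) S_{A₂,b}(n₂),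
-- where the i-sums separate because c_A(i,n) = 0 for i > n. As (−1)ⁿ = (−1)^n₁ (−1)^n₂, multiplying by (−1)ⁿ
-- turns every summand into a product of two non-negative numbers.

module Submission where

open import Defs
open import Algebra.Bundles using (CommutativeSemiring)
open import Data.Nat using (ℕ; zero; suc)
import Data.Nat as ℕ
import Data.Nat.Properties as ℕ
open import Data.List using (List; []; _∷_; _++_; map)
open import Data.Product using (_×_; _,_; uncurry)
open import Data.Sum using (inj₁; inj₂)
open import Level using (0ℓ)
open import Relation.Binary.Bundles using (Setoid)
open import Relation.Binary.PropositionalEquality as ≡ using (_≡_)

antidiagonal : ℕ → List (ℕ × ℕ)
antidiagonal zero    = (0 , 0) ∷ []
antidiagonal (suc n) = (0 , suc n) ∷ map (λ (a , b) → suc a , b) (antidiagonal n)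

module SemiringSums (𝓡 : CommutativeSemiring 0ℓ 0ℓ) where

  open import Data.Nat using (_∸_; _≤_; _<_; z≤n; s≤s)
  open CommutativeSemiring 𝓡
  open import Algebra.Properties.CommutativeSemigroup +-commutativeSemigroup using (interchange)
  open import Relation.Binary.Reasoning.Setoid setoid
  import Relation.Binary.Reasoning.Setoid

  ∑ : {X : Set} → List X → (X → Carrier) → Carrier
  ∑ []       f = 0#
  ∑ (x ∷ xs) f = f x + ∑ xs f

  infix 10 ∑
  syntax ∑ xs (λ x → e) = ∑[ x ∈ xs ] e

  ∑-cong : {X : Set} (xs : List X) {f g : X → Carrier} → (∀ x → f x ≈ g x) → ∑ xs f ≈ ∑ xs g
  ∑-cong []       f≈g = refl
  ∑-cong (x ∷ xs) f≈g = +-cong (f≈g x) (∑-cong xs f≈g)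

  ∑-zero : {X : Set} (xs : List X) {f : X → Carrier} → (∀ x → f x ≈ 0#) → ∑ xs f ≈ 0#
  ∑-zero []       f≈0 = refl
  ∑-zero (x ∷ xs) f≈0 = trans (+-cong (f≈0 x) (∑-zero xs f≈0)) (+-identityˡ 0#)

  ∑-++ : {X : Set} (xs ys : List X) (f : X → Carrier) → ∑ (xs ++ ys) f ≈ ∑ xs f + ∑ ys f
  ∑-++ []       ys f = sym (+-identityˡ _)
  ∑-++ (x ∷ xs) ys f = trans (+-congˡ (∑-++ xs ys f)) (sym (+-assoc _ _ _))

  ∑-map : {X Y : Set} (h : X → Y) (xs : List X) (f : Y → Carrier) → ∑ (map h xs) f ≈ ∑[ x ∈ xs ] f (h x)
  ∑-map h []       f = refl
  ∑-map h (x ∷ xs) f = +-congˡ (∑-map h xs f)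

  ∑-distrib-+ : {X : Set} (xs : List X) (f g : X → Carrier) → ∑[ x ∈ xs ] (f x + g x) ≈ ∑ xs f + ∑ xs g
  ∑-distrib-+ []       f g = sym (+-identityˡ 0#)
  ∑-distrib-+ (x ∷ xs) f g = trans (+-congˡ (∑-distrib-+ xs f g)) (interchange _ _ _ _)

  *-distribˡ-∑ : {X : Set} (c : Carrier) (xs : List X) (f : X → Carrier) → c * ∑ xs f ≈ ∑[ x ∈ xs ] (c * f x)
  *-distribˡ-∑ c []       f = zeroʳ c
  *-distribˡ-∑ c (x ∷ xs) f = trans (distribˡ c _ _) (+-congˡ (*-distribˡ-∑ c xs f))

  *-distribʳ-∑ : {X : Set} (c : Carrier) (xs : List X) (f : X → Carrier) → ∑ xs f * c ≈ ∑[ x ∈ xs ] (f x * c)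
  *-distribʳ-∑ c []       f = zeroˡ c
  *-distribʳ-∑ c (x ∷ xs) f = trans (distribʳ c _ _) (+-congˡ (*-distribʳ-∑ c xs f))

  *-distribˡ-∑∑ : {X Y : Set} (c : Carrier) (xs : List X) (ys : List Y) (F : X → Y → Carrier) →
    c * ∑[ x ∈ xs ] ∑[ y ∈ ys ] F x y ≈ ∑[ x ∈ xs ] ∑[ y ∈ ys ] (c * F x y)
  *-distribˡ-∑∑ c xs ys F = trans (*-distribˡ-∑ c xs _) (∑-cong xs (λ x → *-distribˡ-∑ c ys (F x)))

  ∑-comm : {X Y : Set} (xs : List X) (ys : List Y) (F : X → Y → Carrier) →
    ∑[ x ∈ xs ] ∑[ y ∈ ys ] F x y ≈ ∑[ y ∈ ys ] ∑[ x ∈ xs ] F x y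
  ∑-comm []       ys F = sym (∑-zero ys (λ _ → refl))
  ∑-comm (x ∷ xs) ys F = begin
    ∑ ys (F x) + ∑[ x′ ∈ xs ] ∑ ys (F x′)         ≈⟨ +-congˡ (∑-comm xs ys F) ⟩
    ∑ ys (F x) + ∑[ y ∈ ys ] ∑[ x′ ∈ xs ] F x′ y  ≈⟨ ∑-distrib-+ ys (F x) _ ⟨
    ∑[ y ∈ ys ] (F x y + ∑[ x′ ∈ xs ] F x′ y)     ∎

  ∑≤ : ℕ → (ℕ → Carrier) → Carrier
  ∑≤ zero    f = f 0
  ∑≤ (suc n) f = ∑≤ n f + f (suc n)

  infix 10 ∑≤
  syntax ∑≤ n (λ i → e) = ∑[ i ≤ n ] e

  ∑≤-cong : ∀ n {f g : ℕ → Carrier} → (∀ i → f i ≈ g i) → ∑≤ n f ≈ ∑≤ n g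
  ∑≤-cong zero    f≈g = f≈g 0
  ∑≤-cong (suc n) f≈g = +-cong (∑≤-cong n f≈g) (f≈g (suc n))

  ∑≤-zero : ∀ n {f : ℕ → Carrier} → (∀ i → f i ≈ 0#) → ∑≤ n f ≈ 0#
  ∑≤-zero zero    f≈0 = f≈0 0
  ∑≤-zero (suc n) f≈0 = trans (+-cong (∑≤-zero n f≈0) (f≈0 (suc n))) (+-identityˡ 0#)

  ∑≤-head : ∀ n (f : ℕ → Carrier) → ∑≤ (suc n) f ≈ f 0 + ∑[ i ≤ n ] f (suc i)
  ∑≤-head zero    f = refl
  ∑≤-head (suc n) f = trans (+-congʳ (∑≤-head n f)) (+-assoc _ _ _)

  ∑≤-truncate : ∀ {m n} (f : ℕ → Carrier) → m ≤ n → (∀ i → m < i → f i ≈ 0#) → ∑≤ n f ≈ ∑≤ m f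
  ∑≤-truncate {n = zero}  f z≤n f≈0 = refl
  ∑≤-truncate {n = suc n} f m≤1+n f≈0 with ℕ.m≤n⇒m<n∨m≡n m≤1+n
  ... | inj₁ m<1+n = trans (+-cong (∑≤-truncate f (ℕ.≤-pred m<1+n) f≈0) (f≈0 (suc n) m<1+n)) (+-identityʳ _)
  ... | inj₂ ≡.refl = refl

  ∑≤-distrib-+ : ∀ n (f g : ℕ → Carrier) → ∑[ i ≤ n ] (f i + g i) ≈ ∑≤ n f + ∑≤ n g
  ∑≤-distrib-+ zero    f g = refl
  ∑≤-distrib-+ (suc n) f g = trans (+-congʳ (∑≤-distrib-+ n f g)) (interchange _ _ _ _)

  *-distribˡ-∑≤ : ∀ c n (f : ℕ → Carrier) → c * ∑≤ n f ≈ ∑[ i ≤ n ] (c * f i)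
  *-distribˡ-∑≤ c zero    f = refl
  *-distribˡ-∑≤ c (suc n) f = trans (distribˡ c _ _) (+-congʳ (*-distribˡ-∑≤ c n f))

  *-distribʳ-∑≤ : ∀ c n (f : ℕ → Carrier) → ∑≤ n f * c ≈ ∑[ i ≤ n ] (f i * c)
  *-distribʳ-∑≤ c zero    f = refl
  *-distribʳ-∑≤ c (suc n) f = trans (distribʳ c _ _) (+-congʳ (*-distribʳ-∑≤ c n f))

  ∑≤-∑-comm : ∀ n {X : Set} (xs : List X) (F : ℕ → X → Carrier) →
    ∑[ i ≤ n ] ∑[ x ∈ xs ] F i x ≈ ∑[ x ∈ xs ] ∑[ i ≤ n ] F i x
  ∑≤-∑-comm zero    xs F = refl
  ∑≤-∑-comm (suc n) xs F = begin
    ∑[ i ≤ n ] ∑ xs (F i) + ∑ xs (F (suc n))        ≈⟨ +-congʳ (∑≤-∑-comm n xs F) ⟩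
    ∑[ x ∈ xs ] ∑[ i ≤ n ] F i x + ∑ xs (F (suc n)) ≈⟨ ∑-distrib-+ xs _ (F (suc n)) ⟨
    ∑[ x ∈ xs ] (∑[ i ≤ n ] F i x + F (suc n) x)    ∎

  ∑₂ : List (ℕ × ℕ) → (ℕ → ℕ → Carrier) → Carrier
  ∑₂ ps F = ∑ ps (uncurry F)

  infix 10 ∑₂
  syntax ∑₂ ps (λ a b → e) = ∑[ a , b ∈ ps ] e

  ∑anti : ℕ → (ℕ → ℕ → Carrier) → Carrier
  ∑anti n = ∑₂ (antidiagonal n)

  infix 10 ∑anti
  syntax ∑anti n (λ a b → e) = ∑[ a + b ≡ n ] e

  ∑anti-suc : ∀ n F → ∑anti (suc n) F ≈ F 0 (suc n) + ∑[ a + b ≡ n ] F (suc a) b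
  ∑anti-suc n F = +-congˡ (∑-map _ (antidiagonal n) (uncurry F))

  ∑anti-cong : ∀ n {F G : ℕ → ℕ → Carrier} → (∀ a b → a ℕ.+ b ≡ n → F a b ≈ G a b) →
    ∑anti n F ≈ ∑anti n G
  ∑anti-cong zero    F≈G = +-congʳ (F≈G 0 0 ≡.refl)
  ∑anti-cong (suc n) {F} {G} F≈G = begin
    ∑anti (suc n) F                          ≈⟨ ∑anti-suc n F ⟩
    F 0 (suc n) + ∑[ a + b ≡ n ] F (suc a) b ≈⟨ +-cong (F≈G 0 (suc n) ≡.refl)
                                                  (∑anti-cong n (λ a b a+b≡n → F≈G (suc a) b (≡.cong suc a+b≡n))) ⟩
    G 0 (suc n) + ∑[ a + b ≡ n ] G (suc a) b ≈⟨ ∑anti-suc n G ⟨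
    ∑anti (suc n) G                          ∎

  ∑anti-zero : ∀ n {F : ℕ → ℕ → Carrier} → (∀ a b → F a b ≈ 0#) → ∑anti n F ≈ 0#
  ∑anti-zero n F≈0 = ∑-zero (antidiagonal n) (λ (a , b) → F≈0 a b)

  ∑anti-head : ∀ n F → (∀ a b → F (suc a) b ≈ 0#) → ∑anti n F ≈ F 0 n
  ∑anti-head zero    F _   = +-identityʳ _
  ∑anti-head (suc n) F F≈0 = trans (∑anti-suc n F) (trans (+-congˡ (∑anti-zero n F≈0)) (+-identityʳ _))

  ∑anti-last : ∀ n F → ∑anti (suc n) F ≈ ∑[ a + b ≡ n ] F a (suc b) + F (suc n) 0
  ∑anti-last zero    F = trans (+-congˡ (+-identityʳ _)) (+-congʳ (sym (+-identityʳ _)))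
  ∑anti-last (suc n) F = begin
    ∑anti (suc (suc n)) F
      ≈⟨ ∑anti-suc (suc n) F ⟩
    F 0 (suc (suc n)) + ∑[ a + b ≡ suc n ] F (suc a) b
      ≈⟨ +-congˡ (∑anti-last n (λ a b → F (suc a) b)) ⟩
    F 0 (suc (suc n)) + (∑[ a + b ≡ n ] F (suc a) (suc b) + F (suc (suc n)) 0)
      ≈⟨ +-assoc _ _ _ ⟨
    F 0 (suc (suc n)) + ∑[ a + b ≡ n ] F (suc a) (suc b) + F (suc (suc n)) 0
      ≈⟨ +-congʳ (∑anti-suc n (λ a b → F a (suc b))) ⟨
    ∑[ a + b ≡ suc n ] F a (suc b) + F (suc (suc n)) 0
      ∎

  ∑anti-swap : ∀ n F → ∑anti n F ≈ ∑[ a + b ≡ n ] F b a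
  ∑anti-swap zero    F = refl
  ∑anti-swap (suc n) F = begin
    ∑anti (suc n) F                          ≈⟨ ∑anti-suc n F ⟩
    F 0 (suc n) + ∑[ a + b ≡ n ] F (suc a) b ≈⟨ +-congˡ (∑anti-swap n (λ a b → F (suc a) b)) ⟩
    F 0 (suc n) + ∑[ a + b ≡ n ] F (suc b) a ≈⟨ +-comm _ _ ⟩
    ∑[ a + b ≡ n ] F (suc b) a + F 0 (suc n) ≈⟨ ∑anti-last n (λ a b → F b a) ⟨
    ∑[ a + b ≡ suc n ] F b a                 ∎

  ∑anti-assoc : ∀ n (F : ℕ → ℕ → ℕ → Carrier) →
    ∑[ s + c ≡ n ] ∑[ a + b ≡ s ] F a b c ≈ ∑[ a + t ≡ n ] ∑[ b + c ≡ t ] F a b c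
  ∑anti-assoc zero    F = refl
  ∑anti-assoc (suc n) F = begin
    ∑[ s + c ≡ suc n ] ∑[ a + b ≡ s ] F a b c
      ≈⟨ ∑anti-suc n _ ⟩
    (F 0 0 (suc n) + 0#) + ∑[ s + c ≡ n ] ∑[ a + b ≡ suc s ] F a b c
      ≈⟨ +-cong (+-identityʳ _) (∑anti-cong n (λ s c _ → ∑anti-suc s (λ a b → F a b c))) ⟩
    F 0 0 (suc n) + ∑[ s + c ≡ n ] (F 0 (suc s) c + ∑[ a + b ≡ s ] F (suc a) b c)
      ≈⟨ +-congˡ (∑-distrib-+ (antidiagonal n) _ _) ⟩
    F 0 0 (suc n) + (∑[ s + c ≡ n ] F 0 (suc s) c + ∑[ s + c ≡ n ] ∑[ a + b ≡ s ] F (suc a) b c)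
      ≈⟨ +-congˡ (+-congˡ (∑anti-assoc n (λ a → F (suc a)))) ⟩
    F 0 0 (suc n) + (∑[ s + c ≡ n ] F 0 (suc s) c + ∑[ a + t ≡ n ] ∑[ b + c ≡ t ] F (suc a) b c)
      ≈⟨ +-assoc _ _ _ ⟨
    F 0 0 (suc n) + ∑[ s + c ≡ n ] F 0 (suc s) c + ∑[ a + t ≡ n ] ∑[ b + c ≡ t ] F (suc a) b c
      ≈⟨ +-congʳ (∑anti-suc n (F 0)) ⟨
    ∑[ b + c ≡ suc n ] F 0 b c + ∑[ a + t ≡ n ] ∑[ b + c ≡ t ] F (suc a) b c
      ≈⟨ ∑anti-suc n _ ⟨
    ∑[ a + t ≡ suc n ] ∑[ b + c ≡ t ] F a b c
      ∎

  ∑anti-as-∑≤ : ∀ n F → ∑anti n F ≈ ∑[ i ≤ n ] F i (n ∸ i)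
  ∑anti-as-∑≤ zero    F = +-identityʳ _
  ∑anti-as-∑≤ (suc n) F =
    trans (∑anti-suc n F) (trans (+-congˡ (∑anti-as-∑≤ n (λ a → F (suc a)))) (sym (∑≤-head n _)))

  ∑≤-antidiagonals : ∀ m n F → (∀ a b → m < a → F a b ≈ 0#) → (∀ a b → n < b → F a b ≈ 0#) →
    ∑[ i ≤ m ℕ.+ n ] ∑anti i F ≈ ∑[ a ≤ m ] ∑[ b ≤ n ] F a b
  ∑≤-antidiagonals zero    n F F≈0ˡ _ = ∑≤-cong n (λ i → ∑anti-head i F (λ a b → F≈0ˡ (suc a) b (s≤s z≤n)))
  ∑≤-antidiagonals (suc m) n F F≈0ˡ F≈0ʳ = begin
    ∑[ i ≤ suc (m ℕ.+ n) ] ∑anti i F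
      ≈⟨ ∑≤-head (m ℕ.+ n) _ ⟩
    ∑anti 0 F + ∑[ i ≤ m ℕ.+ n ] ∑anti (suc i) F
      ≈⟨ +-cong (+-identityʳ _) (∑≤-cong (m ℕ.+ n) (λ i → ∑anti-suc i F)) ⟩
    F 0 0 + ∑[ i ≤ m ℕ.+ n ] (F 0 (suc i) + ∑[ a + b ≡ i ] F (suc a) b)
      ≈⟨ +-congˡ (∑≤-distrib-+ (m ℕ.+ n) _ _) ⟩
    F 0 0 + (∑[ i ≤ m ℕ.+ n ] F 0 (suc i) + ∑[ i ≤ m ℕ.+ n ] ∑[ a + b ≡ i ] F (suc a) b)
      ≈⟨ +-congˡ (+-congˡ (∑≤-antidiagonals m n (λ a → F (suc a))
                             (λ a b m<a → F≈0ˡ (suc a) b (s≤s m<a)) (λ a → F≈0ʳ (suc a)))) ⟩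
    F 0 0 + (∑[ i ≤ m ℕ.+ n ] F 0 (suc i) + ∑[ a ≤ m ] ∑[ b ≤ n ] F (suc a) b)
      ≈⟨ +-assoc _ _ _ ⟨
    F 0 0 + ∑[ i ≤ m ℕ.+ n ] F 0 (suc i) + ∑[ a ≤ m ] ∑[ b ≤ n ] F (suc a) b
      ≈⟨ +-congʳ (∑≤-head (m ℕ.+ n) (F 0)) ⟨
    ∑[ b ≤ suc (m ℕ.+ n) ] F 0 b + ∑[ a ≤ m ] ∑[ b ≤ n ] F (suc a) b
      ≈⟨ +-congʳ (∑≤-truncate (F 0) (ℕ.≤-trans (ℕ.m≤n+m n m) (ℕ.n≤1+n _)) (F≈0ʳ 0)) ⟩
    ∑[ b ≤ n ] F 0 b + ∑[ a ≤ m ] ∑[ b ≤ n ] F (suc a) b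
      ≈⟨ ∑≤-head m _ ⟨
    ∑[ a ≤ suc m ] ∑[ b ≤ n ] F a b
      ∎

  ∑≤-cauchy : ∀ m n (u v : ℕ → Carrier) → (∀ a → m < a → u a ≈ 0#) → (∀ b → n < b → v b ≈ 0#) →
    ∑[ i ≤ m ℕ.+ n ] ∑[ a + b ≡ i ] (u a * v b) ≈ ∑≤ m u * ∑≤ n v
  ∑≤-cauchy m n u v u≈0 v≈0 = begin
    ∑[ i ≤ m ℕ.+ n ] ∑[ a + b ≡ i ] (u a * v b) ≈⟨ ∑≤-antidiagonals m n _
                                                      (λ a b m<a → trans (*-congʳ (u≈0 a m<a)) (zeroˡ _))
                                                      (λ a b n<b → trans (*-congˡ (v≈0 b n<b)) (zeroʳ _)) ⟩
    ∑[ a ≤ m ] ∑[ b ≤ n ] (u a * v b)           ≈⟨ ∑≤-cong m (λ a → *-distribˡ-∑≤ (u a) n v) ⟨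
    ∑[ a ≤ m ] (u a * ∑≤ n v)                   ≈⟨ *-distribʳ-∑≤ _ m u ⟨
    ∑≤ m u * ∑≤ n v                             ∎

  _≈₂_ : (f g : ℕ → ℕ → Carrier) → Set
  f ≈₂ g = ∀ i n → f i n ≈ g i n

  ≈₂-setoid : Setoid 0ℓ 0ℓ
  ≈₂-setoid = record
    { Carrier       = ℕ → ℕ → Carrier
    ; _≈_           = _≈₂_
    ; isEquivalence = record
      { refl  = λ _ _ → refl
      ; sym   = λ f≈g i n → sym (f≈g i n)
      ; trans = λ f≈g g≈h i n → trans (f≈g i n) (g≈h i n)
      }
    }

  module ≈₂-Reasoning = Relation.Binary.Reasoning.Setoid ≈₂-setoid

  infixl 7 _⊛_
  _⊛_ : (f g : ℕ → ℕ → Carrier) → ℕ → ℕ → Carrier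
  (f ⊛ g) i n = ∑[ i₁ + i₂ ≡ i ] ∑[ n₁ + n₂ ≡ n ] (f i₁ n₁ * g i₂ n₂)

  δ : ℕ → ℕ → Carrier
  δ zero    zero    = 1#
  δ zero    (suc _) = 0#
  δ (suc _) _       = 0#

  ⊛-cong : ∀ {f f′ g g′} → f ≈₂ f′ → g ≈₂ g′ → (f ⊛ g) ≈₂ (f′ ⊛ g′)
  ⊛-cong f≈f′ g≈g′ i n =
    ∑anti-cong i (λ i₁ i₂ _ → ∑anti-cong n (λ n₁ n₂ _ → *-cong (f≈f′ i₁ n₁) (g≈g′ i₂ n₂)))

  ⊛-congˡ : ∀ {f f′} g → f ≈₂ f′ → (f ⊛ g) ≈₂ (f′ ⊛ g)
  ⊛-congˡ g f≈f′ = ⊛-cong f≈f′ (λ _ _ → refl)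

  ⊛-congʳ : ∀ f {g g′} → g ≈₂ g′ → (f ⊛ g) ≈₂ (f ⊛ g′)
  ⊛-congʳ f g≈g′ = ⊛-cong (λ _ _ → refl) g≈g′

  ⊛-identityˡ : ∀ f → (δ ⊛ f) ≈₂ f
  ⊛-identityˡ f i n = begin
    (δ ⊛ f) i n                            ≈⟨ ∑anti-head i _ (λ _ _ → ∑anti-zero n (λ _ _ → zeroˡ _)) ⟩
    ∑[ n₁ + n₂ ≡ n ] (δ 0 n₁ * f i n₂)     ≈⟨ ∑anti-head n _ (λ _ _ → zeroˡ _) ⟩
    1# * f i n                             ≈⟨ *-identityˡ _ ⟩
    f i n                                  ∎

  ⊛-comm : ∀ f g → (f ⊛ g) ≈₂ (g ⊛ f)
  ⊛-comm f g i n = begin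
    ∑[ i₁ + i₂ ≡ i ] ∑[ n₁ + n₂ ≡ n ] (f i₁ n₁ * g i₂ n₂) ≈⟨ ∑anti-cong i (λ _ _ _ → ∑anti-cong n λ _ _ _ → *-comm _ _) ⟩
    ∑[ i₁ + i₂ ≡ i ] ∑[ n₁ + n₂ ≡ n ] (g i₂ n₂ * f i₁ n₁) ≈⟨ ∑anti-cong i (λ _ _ _ → ∑anti-swap n _) ⟩
    ∑[ i₁ + i₂ ≡ i ] ∑[ n₁ + n₂ ≡ n ] (g i₂ n₁ * f i₁ n₂) ≈⟨ ∑anti-swap i _ ⟩
    ∑[ i₁ + i₂ ≡ i ] ∑[ n₁ + n₂ ≡ n ] (g i₁ n₁ * f i₂ n₂) ∎

  ⊛-assoc : ∀ f g h → (f ⊛ g ⊛ h) ≈₂ (f ⊛ (g ⊛ h))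
  ⊛-assoc f g h i n = begin
    (f ⊛ g ⊛ h) i n
      ≈⟨ ∑anti-cong i (λ p i₃ _ → ∑anti-cong n (λ s n₃ _ → begin
           (f ⊛ g) p s * h i₃ n₃
             ≈⟨ *-distribʳ-∑ _ (antidiagonal p) _ ⟩
           ∑[ i₁ + i₂ ≡ p ] (∑[ n₁ + n₂ ≡ s ] (f i₁ n₁ * g i₂ n₂) * h i₃ n₃)
             ≈⟨ ∑anti-cong p (λ _ _ _ → *-distribʳ-∑ _ (antidiagonal s) _) ⟩
           ∑[ i₁ + i₂ ≡ p ] ∑[ n₁ + n₂ ≡ s ] (f i₁ n₁ * g i₂ n₂ * h i₃ n₃)
             ∎)) ⟩
    ∑[ p + i₃ ≡ i ] ∑[ s + n₃ ≡ n ] ∑[ i₁ + i₂ ≡ p ] ∑[ n₁ + n₂ ≡ s ] X i₁ i₂ i₃ n₁ n₂ n₃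
      ≈⟨ ∑anti-cong i (λ p _ _ → ∑-comm (antidiagonal n) (antidiagonal p) _) ⟩
    ∑[ p + i₃ ≡ i ] ∑[ i₁ + i₂ ≡ p ] ∑[ s + n₃ ≡ n ] ∑[ n₁ + n₂ ≡ s ] X i₁ i₂ i₃ n₁ n₂ n₃
      ≈⟨ ∑anti-assoc i _ ⟩
    ∑[ i₁ + t ≡ i ] ∑[ i₂ + i₃ ≡ t ] ∑[ s + n₃ ≡ n ] ∑[ n₁ + n₂ ≡ s ] X i₁ i₂ i₃ n₁ n₂ n₃
      ≈⟨ ∑anti-cong i (λ i₁ t _ → ∑anti-cong t (λ i₂ i₃ _ → ∑anti-assoc n _)) ⟩
    ∑[ i₁ + t ≡ i ] ∑[ i₂ + i₃ ≡ t ] ∑[ n₁ + u ≡ n ] ∑[ n₂ + n₃ ≡ u ] X i₁ i₂ i₃ n₁ n₂ n₃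
      ≈⟨ ∑anti-cong i (λ _ t _ → ∑-comm (antidiagonal t) (antidiagonal n) _) ⟩
    ∑[ i₁ + t ≡ i ] ∑[ n₁ + u ≡ n ] ∑[ i₂ + i₃ ≡ t ] ∑[ n₂ + n₃ ≡ u ] X i₁ i₂ i₃ n₁ n₂ n₃
      ≈⟨ ∑anti-cong i (λ i₁ t _ → ∑anti-cong n (λ n₁ u _ → begin
           ∑[ i₂ + i₃ ≡ t ] ∑[ n₂ + n₃ ≡ u ] X i₁ i₂ i₃ n₁ n₂ n₃
             ≈⟨ ∑anti-cong t (λ _ _ _ → ∑anti-cong u (λ _ _ _ → *-assoc _ _ _)) ⟩
           ∑[ i₂ + i₃ ≡ t ] ∑[ n₂ + n₃ ≡ u ] (f i₁ n₁ * (g i₂ n₂ * h i₃ n₃))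
             ≈⟨ ∑anti-cong t (λ _ _ _ → *-distribˡ-∑ _ (antidiagonal u) _) ⟨
           ∑[ i₂ + i₃ ≡ t ] (f i₁ n₁ * ∑[ n₂ + n₃ ≡ u ] (g i₂ n₂ * h i₃ n₃))
             ≈⟨ *-distribˡ-∑ _ (antidiagonal t) _ ⟨
           f i₁ n₁ * (g ⊛ h) t u
             ∎)) ⟩
    (f ⊛ (g ⊛ h)) i n
      ∎
    where
    X : ℕ → ℕ → ℕ → ℕ → ℕ → ℕ → Carrier
    X i₁ i₂ i₃ n₁ n₂ n₃ = f i₁ n₁ * g i₂ n₂ * h i₃ n₃

  ⊛-exchange : ∀ e f g → (e ⊛ (f ⊛ g)) ≈₂ (f ⊛ (e ⊛ g))
  ⊛-exchange e f g i n =
    trans (sym (⊛-assoc e f g i n)) (trans (⊛-congˡ g (⊛-comm e f) i n) (⊛-assoc f e g i n))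

module Partitions where

  open import Data.Nat using (_+_; _*_; _∸_; _≤_; _<_; _≤ᵇ_; _≡ᵇ_; z≤n)
  open import Data.Bool using (Bool; true; false; _∧_; _∨_; T)
  open import Data.Empty using (⊥-elim)
  open import Relation.Binary.PropositionalEquality
  open SemiringSums ℕ.+-*-commutativeSemiring

  sumTo≡∑≤ : ∀ n f → sumTo n f ≡ ∑≤ n f
  sumTo≡∑≤ zero    f = refl
  sumTo≡∑≤ (suc n) f = cong (_+ f (suc n)) (sumTo≡∑≤ n f)

  bit-∧-* : ∀ x y q → bit (x ∧ y) * q ≡ bit x * (bit y * q)
  bit-∧-* true  y q = sym (ℕ.+-identityʳ (bit y * q))
  bit-∧-* false y q = refl

  bit-∧-*-zero : ∀ x y q → (T y → q ≡ 0) → bit (x ∧ y) * q ≡ 0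
  bit-∧-*-zero false y     q _   = refl
  bit-∧-*-zero true  false q _   = refl
  bit-∧-*-zero true  true  q q≡0 = trans (ℕ.+-identityʳ q) (q≡0 _)

  ∑anti-indicator : ∀ n s (h : ℕ → ℕ) → ∑[ t + n₂ ≡ n ] (bit (t ≡ᵇ s) * h n₂) ≡ bit (s ≤ᵇ n) * h (n ∸ s)
  ∑anti-indicator zero    zero    h = ℕ.+-identityʳ _
  ∑anti-indicator zero    (suc s) h = refl
  ∑anti-indicator (suc n) zero    h = begin
    ∑[ t + n₂ ≡ suc n ] (bit (t ≡ᵇ 0) * h n₂)
      ≡⟨ ∑anti-suc n (λ t n₂ → bit (t ≡ᵇ 0) * h n₂) ⟩
    1 * h (suc n) + ∑[ t + n₂ ≡ n ] (bit (suc t ≡ᵇ 0) * h n₂)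
      ≡⟨ cong (1 * h (suc n) +_) (∑anti-zero n (λ _ _ → refl)) ⟩
    1 * h (suc n) + 0
      ≡⟨ ℕ.+-identityʳ _ ⟩
    1 * h (suc n)
      ∎
    where open ≡-Reasoning
  ∑anti-indicator (suc n) (suc s) h = begin
    ∑[ t + n₂ ≡ suc n ] (bit (t ≡ᵇ suc s) * h n₂)
      ≡⟨ ∑anti-suc n (λ t n₂ → bit (t ≡ᵇ suc s) * h n₂) ⟩
    ∑[ t + n₂ ≡ n ] (bit (suc t ≡ᵇ suc s) * h n₂)
      ≡⟨ ∑anti-indicator n s h ⟩
    bit (s ≤ᵇ n) * h (n ∸ s)
      ≡⟨ cong (λ b → bit b * h (n ∸ s)) (≤ᵇ-suc s n) ⟩
    bit (suc s ≤ᵇ suc n) * h (n ∸ s)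
      ∎
    where
    open ≡-Reasoning
    ≤ᵇ-suc : ∀ s n → (s ≤ᵇ n) ≡ (suc s ≤ᵇ suc n)
    ≤ᵇ-suc zero    n = refl
    ≤ᵇ-suc (suc s) n = refl

  parts≤ : Subset → ℕ → ℕ → ℕ → ℕ
  parts≤ A m i n = parts A i n m

  -- Coefficient of xʲ qᵗ in 1/(1 − x qᵃ) when b holds, and in 1 otherwise.
  factor : Bool → ℕ → ℕ → ℕ → ℕ
  factor b a j t = bit ((isZero j ∨ b) ∧ (t ≡ᵇ j * a))

  factor-false : ∀ a → factor false a ≈₂ δ
  factor-false a zero    zero    = refl
  factor-false a zero    (suc t) = refl
  factor-false a (suc j) t       = refl

  parts≤-zero : ∀ A → parts≤ A 0 ≈₂ δ
  parts≤-zero A zero    zero    = refl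
  parts≤-zero A zero    (suc n) = refl
  parts≤-zero A (suc i) n       = refl

  parts≤-suc : ∀ A m → parts≤ A (suc m) ≈₂ (factor (A (suc m)) (suc m) ⊛ parts≤ A m)
  parts≤-suc A m i n = begin
    sumTo i (λ j → bit (B j ∧ (j * a ≤ᵇ n)) * parts A (i ∸ j) (n ∸ j * a) m)
      ≡⟨ sumTo≡∑≤ i _ ⟩
    ∑[ j ≤ i ] (bit (B j ∧ (j * a ≤ᵇ n)) * parts A (i ∸ j) (n ∸ j * a) m)
      ≡⟨ ∑≤-cong i (λ j → bit-∧-* (B j) _ _) ⟩
    ∑[ j ≤ i ] (bit (B j) * (bit (j * a ≤ᵇ n) * parts A (i ∸ j) (n ∸ j * a) m))
      ≡⟨ ∑anti-as-∑≤ i (λ j i₂ → bit (B j) * (bit (j * a ≤ᵇ n) * parts A i₂ (n ∸ j * a) m)) ⟨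
    ∑[ j + i₂ ≡ i ] (bit (B j) * (bit (j * a ≤ᵇ n) * parts A i₂ (n ∸ j * a) m))
      ≡⟨ ∑anti-cong i (λ j i₂ _ → inner j i₂) ⟨
    (factor (A a) a ⊛ parts≤ A m) i n
      ∎
    where
    open ≡-Reasoning
    a = suc m
    B : ℕ → Bool
    B j = isZero j ∨ A a
    inner : ∀ j i₂ → ∑[ t + n₂ ≡ n ] (factor (A a) a j t * parts A i₂ n₂ m)
                   ≡ bit (B j) * (bit (j * a ≤ᵇ n) * parts A i₂ (n ∸ j * a) m)
    inner j i₂ = begin
      ∑[ t + n₂ ≡ n ] (factor (A a) a j t * parts A i₂ n₂ m)
        ≡⟨ ∑anti-cong n (λ t _ _ → bit-∧-* (B j) (t ≡ᵇ j * a) _) ⟩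
      ∑[ t + n₂ ≡ n ] (bit (B j) * (bit (t ≡ᵇ j * a) * parts A i₂ n₂ m))
        ≡⟨ *-distribˡ-∑ (bit (B j)) (antidiagonal n) _ ⟨
      bit (B j) * ∑[ t + n₂ ≡ n ] (bit (t ≡ᵇ j * a) * parts A i₂ n₂ m)
        ≡⟨ cong (bit (B j) *_) (∑anti-indicator n (j * a) (parts≤ A m i₂)) ⟩
      bit (B j) * (bit (j * a ≤ᵇ n) * parts A i₂ (n ∸ j * a) m)
        ∎

  parts-triangular : ∀ A m {i n} → n < i → parts A i n m ≡ 0
  parts-triangular A zero    {suc i} n<i = refl
  parts-triangular A (suc m) {i} {n} n<i =
    trans (sumTo≡∑≤ i _) (∑≤-zero i term≡0)
    where
    term≡0 : ∀ j → bit ((isZero j ∨ A (suc m)) ∧ (j * suc m ≤ᵇ n)) * parts A (i ∸ j) (n ∸ j * suc m) m ≡ 0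
    term≡0 zero    = trans (ℕ.+-identityʳ _) (parts-triangular A m n<i)
    term≡0 (suc j) = bit-∧-*-zero (A (suc m)) _ _ λ le →
      parts-triangular A m (remainder-< (ℕ.≤ᵇ⇒≤ (suc j * suc m) n le))
      where
      sj≤sj*sm : suc j ≤ suc j * suc m
      sj≤sj*sm = ℕ.m≤m*n (suc j) (suc m)
      remainder-< : suc j * suc m ≤ n → n ∸ suc j * suc m < i ∸ suc j
      remainder-< le = ℕ.≤-<-trans (ℕ.∸-monoʳ-≤ n sj≤sj*sm) (ℕ.∸-monoˡ-< n<i (ℕ.≤-trans sj≤sj*sm le))

  c-triangular : ∀ A {i n} → n < i → c A i n ≡ 0
  c-triangular A {n = n} = parts-triangular A n

  parts-stable-suc : ∀ A m {i n} → n < suc m → parts A i n (suc m) ≡ parts A i n m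
  parts-stable-suc A m {i} {n} n<1+m =
    trans (sumTo≡∑≤ i _) (trans (∑≤-truncate _ (z≤n {i}) term≡0) (ℕ.+-identityʳ _))
    where
    term≡0 : ∀ j → 0 < j →
             bit ((isZero j ∨ A (suc m)) ∧ (j * suc m ≤ᵇ n)) * parts A (i ∸ j) (n ∸ j * suc m) m ≡ 0
    term≡0 (suc j) _ = bit-∧-*-zero (A (suc m)) _ _ λ le →
      ⊥-elim (ℕ.<⇒≱ n<1+m (ℕ.≤-trans (ℕ.m≤n*m (suc m) (suc j)) (ℕ.≤ᵇ⇒≤ (suc j * suc m) n le)))

  parts-stable : ∀ A {m i n} → n ≤ m → parts A i n m ≡ c A i n
  parts-stable A n≤m with ℕ.m≤n⇒m<n∨m≡n n≤m
  ... | inj₂ refl = refl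
  parts-stable A {suc m} _ | inj₁ n<1+m =
    trans (parts-stable-suc A m n<1+m) (parts-stable A (ℕ.≤-pred n<1+m))

  factor-false-⊛ : ∀ a f → (factor false a ⊛ f) ≈₂ f
  factor-false-⊛ a f i n = trans (⊛-congˡ f (factor-false a) i n) (⊛-identityˡ f i n)

  factor-⊛-split : ∀ a b₁ b₂ → b₁ ∧ b₂ ≡ false → ∀ f g →
    (factor (b₁ ∨ b₂) a ⊛ (f ⊛ g)) ≈₂ (factor b₁ a ⊛ f ⊛ (factor b₂ a ⊛ g))
  factor-⊛-split a true  false _ f g = begin
    factor true a ⊛ (f ⊛ g)                     ≈⟨ ⊛-assoc (factor true a) f g ⟨
    factor true a ⊛ f ⊛ g                       ≈⟨ ⊛-congʳ (factor true a ⊛ f) (factor-false-⊛ a g) ⟨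
    factor true a ⊛ f ⊛ (factor false a ⊛ g)    ∎
    where open ≈₂-Reasoning
  factor-⊛-split a false true  _ f g = begin
    factor true a ⊛ (f ⊛ g)                     ≈⟨ ⊛-exchange (factor true a) f g ⟩
    f ⊛ (factor true a ⊛ g)                     ≈⟨ ⊛-congˡ (factor true a ⊛ g) (factor-false-⊛ a f) ⟨
    factor false a ⊛ f ⊛ (factor true a ⊛ g)    ∎
    where open ≈₂-Reasoning
  factor-⊛-split a false false _ f g = begin
    factor false a ⊛ (f ⊛ g)                    ≈⟨ factor-false-⊛ a (f ⊛ g) ⟩
    f ⊛ g                                       ≈⟨ ⊛-cong (factor-false-⊛ a f) (factor-false-⊛ a g) ⟨
    factor false a ⊛ f ⊛ (factor false a ⊛ g)   ∎
    where open ≈₂-Reasoning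

  parts≤-∪ : ∀ {A₁ A₂} → Disjoint A₁ A₂ → ∀ m → parts≤ (A₁ ∪ A₂) m ≈₂ (parts≤ A₁ m ⊛ parts≤ A₂ m)
  parts≤-∪ {A₁} {A₂} disjoint zero = begin
    parts≤ (A₁ ∪ A₂) 0        ≈⟨ parts≤-zero (A₁ ∪ A₂) ⟩
    δ                         ≈⟨ ⊛-identityˡ δ ⟨
    δ ⊛ δ                     ≈⟨ ⊛-cong (parts≤-zero A₁) (parts≤-zero A₂) ⟨
    parts≤ A₁ 0 ⊛ parts≤ A₂ 0 ∎
    where open ≈₂-Reasoning
  parts≤-∪ {A₁} {A₂} disjoint (suc m) = begin
    parts≤ (A₁ ∪ A₂) (suc m)
      ≈⟨ parts≤-suc (A₁ ∪ A₂) m ⟩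
    factor (A₁ a ∨ A₂ a) a ⊛ parts≤ (A₁ ∪ A₂) m
      ≈⟨ ⊛-congʳ (factor (A₁ a ∨ A₂ a) a) (parts≤-∪ disjoint m) ⟩
    factor (A₁ a ∨ A₂ a) a ⊛ (parts≤ A₁ m ⊛ parts≤ A₂ m)
      ≈⟨ factor-⊛-split a (A₁ a) (A₂ a) (disjoint m) _ _ ⟩
    factor (A₁ a) a ⊛ parts≤ A₁ m ⊛ (factor (A₂ a) a ⊛ parts≤ A₂ m)
      ≈⟨ ⊛-cong (parts≤-suc A₁ m) (parts≤-suc A₂ m) ⟨
    parts≤ A₁ (suc m) ⊛ parts≤ A₂ (suc m)
      ∎
    where
    open ≈₂-Reasoning
    a = suc m

  c-∪ : ∀ {A₁ A₂} → Disjoint A₁ A₂ → c (A₁ ∪ A₂) ≈₂ (c A₁ ⊛ c A₂)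
  c-∪ {A₁} {A₂} disjoint i n = trans (parts≤-∪ disjoint n i n)
    (∑anti-cong i (λ i₁ i₂ _ → ∑anti-cong n (λ n₁ n₂ n₁+n₂≡n →
      cong₂ _*_ (parts-stable A₁ {i = i₁} (subst (n₁ ≤_) n₁+n₂≡n (ℕ.m≤m+n n₁ n₂)))
                (parts-stable A₂ {i = i₂} (subst (n₂ ≤_) n₁+n₂≡n (ℕ.m≤n+m n₂ n₁))))))

-- One pair (a , b) for each of the 2ᵏ terms xᵃ yᵇ of the expanded product (x + y)ᵏ.
exponentPairs : ℕ → List (ℕ × ℕ)
exponentPairs zero    = (0 , 0) ∷ []
exponentPairs (suc k) =
  map (λ (a , b) → suc a , b) (exponentPairs k) ++ map (λ (a , b) → a , suc b) (exponentPairs k)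

module PowerExpansion where

  open import Data.Nat using (_+_; _*_; _^_)
  open import Relation.Binary.PropositionalEquality using (refl; sym; cong; cong₂; module ≡-Reasoning)
  open import Algebra.Properties.CommutativeSemigroup ℕ.*-commutativeSemigroup using (x∙yz≈y∙xz)
  open SemiringSums ℕ.+-*-commutativeSemiring
  open ≡-Reasoning

  ^-+-expand : ∀ k x y → (x + y) ^ k ≡ ∑[ a , b ∈ exponentPairs k ] (x ^ a * y ^ b)
  ^-+-expand zero    x y = refl
  ^-+-expand (suc k) x y = begin
    (x + y) * (x + y) ^ k
      ≡⟨ ℕ.*-distribʳ-+ _ x y ⟩
    x * (x + y) ^ k + y * (x + y) ^ k
      ≡⟨ cong₂ _+_ (cong (x *_) (^-+-expand k x y)) (cong (y *_) (^-+-expand k x y)) ⟩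
    x * ∑[ a , b ∈ E ] (x ^ a * y ^ b) + y * ∑[ a , b ∈ E ] (x ^ a * y ^ b)
      ≡⟨ cong₂ _+_ (*-distribˡ-∑ x E _) (*-distribˡ-∑ y E _) ⟩
    ∑[ a , b ∈ E ] (x * (x ^ a * y ^ b)) + ∑[ a , b ∈ E ] (y * (x ^ a * y ^ b))
      ≡⟨ cong₂ _+_ (∑-cong E (λ (a , b) → sym (ℕ.*-assoc x (x ^ a) (y ^ b))))
                   (∑-cong E (λ (a , b) → x∙yz≈y∙xz y (x ^ a) (y ^ b))) ⟩
    ∑[ a , b ∈ E ] (x ^ suc a * y ^ b) + ∑[ a , b ∈ E ] (x ^ a * y ^ suc b)
      ≡⟨ cong₂ _+_ (∑-map _ E _) (∑-map _ E _) ⟨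
    ∑₂ (map (λ (a , b) → suc a , b) E) (λ a b → x ^ a * y ^ b) +
    ∑₂ (map (λ (a , b) → a , suc b) E) (λ a b → x ^ a * y ^ b)
      ≡⟨ ∑-++ (map _ E) (map _ E) _ ⟨
    ∑[ a , b ∈ exponentPairs (suc k) ] (x ^ a * y ^ b)
      ∎
    where
    E : List (ℕ × ℕ)
    E = exponentPairs k

module SignedMoments where

  open import Data.Integer using (ℤ; +_; _+_; _*_; -_; _≤_; nonNegative)
  import Data.Integer.Properties as ℤ
  open import Data.Integer.Tactic.RingSolver using (solve-∀)
  open import Relation.Binary.PropositionalEquality
  open SemiringSums ℤ.+-*-commutativeSemiring
  open PowerExpansion using (^-+-expand)
  private module ℕΣ = SemiringSums ℕ.+-*-commutativeSemiring

  sumToℤ≡∑≤ : ∀ n f → sumToℤ n f ≡ ∑≤ n f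
  sumToℤ≡∑≤ zero    f = refl
  sumToℤ≡∑≤ (suc n) f = cong (_+ f (suc n)) (sumToℤ≡∑≤ n f)

  pos-∑ : {X : Set} (xs : List X) (f : X → ℕ) → + (ℕΣ.∑ xs f) ≡ ∑[ x ∈ xs ] (+ f x)
  pos-∑ []       f = refl
  pos-∑ (x ∷ xs) f = cong (_+_ (+ f x)) (pos-∑ xs f)

  pos₂ : (ℕ → ℕ → ℕ) → ℕ → ℕ → ℤ
  pos₂ f i n = + f i n

  pos-⊛ : ∀ f g → pos₂ (f ℕΣ.⊛ g) ≈₂ (pos₂ f ⊛ pos₂ g)
  pos-⊛ f g i n = trans (pos-∑ (antidiagonal i) _) (∑anti-cong i (λ i₁ i₂ _ →
    trans (pos-∑ (antidiagonal n) _) (∑anti-cong n (λ n₁ n₂ _ → ℤ.pos-* (f i₁ n₁) (g i₂ n₂)))))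

  sgn-+ : ∀ a b → sgn (a ℕ.+ b) ≡ sgn a * sgn b
  sgn-+ zero    b = sym (ℤ.*-identityˡ (sgn b))
  sgn-+ (suc a) b = trans (cong -_ (sgn-+ a b)) (ℤ.neg-distribˡ-* (sgn a) (sgn b))

  pos-^-+-expand : ∀ k i j → + ((i ℕ.+ j) ℕ.^ k) ≡ ∑[ a , b ∈ exponentPairs k ] (+ (i ℕ.^ a) * + (j ℕ.^ b))
  pos-^-+-expand k i j = begin
    + ((i ℕ.+ j) ℕ.^ k)
      ≡⟨ cong +_ (^-+-expand k i j) ⟩
    + (ℕΣ.∑₂ (exponentPairs k) (λ a b → i ℕ.^ a ℕ.* j ℕ.^ b))
      ≡⟨ pos-∑ (exponentPairs k) _ ⟩
    ∑[ a , b ∈ exponentPairs k ] (+ (i ℕ.^ a ℕ.* j ℕ.^ b))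
      ≡⟨ ∑-cong (exponentPairs k) (λ (a , b) → ℤ.pos-* (i ℕ.^ a) (j ℕ.^ b)) ⟩
    ∑[ a , b ∈ exponentPairs k ] (+ (i ℕ.^ a) * + (j ℕ.^ b))
      ∎
    where open ≡-Reasoning

  signedPower : ℕ → ℕ → ℤ → ℤ
  signedPower k i x = sgn i * (+ (i ℕ.^ k) * x)

  signedPower-+ : ∀ k i j x y →
    signedPower k (i ℕ.+ j) (x * y) ≡ ∑[ a , b ∈ exponentPairs k ] (signedPower a i x * signedPower b j y)
  signedPower-+ k i j x y = begin
    sgn (i ℕ.+ j) * (+ ((i ℕ.+ j) ℕ.^ k) * (x * y))
      ≡⟨ cong₂ _*_ (sgn-+ i j) (cong (_* (x * y)) (pos-^-+-expand k i j)) ⟩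
    sgn i * sgn j * (∑[ a , b ∈ E ] (+ (i ℕ.^ a) * + (j ℕ.^ b)) * (x * y))
      ≡⟨ cong (sgn i * sgn j *_) (*-distribʳ-∑ (x * y) E _) ⟩
    sgn i * sgn j * ∑[ a , b ∈ E ] (+ (i ℕ.^ a) * + (j ℕ.^ b) * (x * y))
      ≡⟨ *-distribˡ-∑ (sgn i * sgn j) E _ ⟩
    ∑[ a , b ∈ E ] (sgn i * sgn j * (+ (i ℕ.^ a) * + (j ℕ.^ b) * (x * y)))
      ≡⟨ ∑-cong E (λ (a , b) → rearrange (sgn i) (sgn j) (+ (i ℕ.^ a)) (+ (j ℕ.^ b)) x y) ⟩
    ∑[ a , b ∈ E ] (signedPower a i x * signedPower b j y)
      ∎
    where
    open ≡-Reasoning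
    E : List (ℕ × ℕ)
    E = exponentPairs k
    rearrange : ∀ s t p q x y → s * t * (p * q * (x * y)) ≡ s * (p * x) * (t * (q * y))
    rearrange = solve-∀

  moment : (ℕ → ℕ → ℤ) → ℕ → ℕ → ℤ
  moment f k n = ∑[ i ≤ n ] signedPower k i (f i n)

  moment-cong : ∀ {f g} → f ≈₂ g → ∀ k n → moment f k n ≡ moment g k n
  moment-cong f≈g k n = ∑≤-cong n (λ i → cong (signedPower k i) (f≈g i n))

  S≡moment : ∀ A k n → S A k n ≡ moment (pos₂ (c A)) k n
  S≡moment A k n =
    trans (sumToℤ≡∑≤ n _) (∑≤-cong n (λ i → cong (sgn i *_) (ℤ.pos-* (i ℕ.^ k) (c A i n))))

  Triangular : (ℕ → ℕ → ℤ) → Set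
  Triangular f = ∀ {i n} → n ℕ.< i → f i n ≡ + 0

  moment-⊛ : ∀ {f g} → Triangular f → Triangular g → ∀ k n →
    moment (f ⊛ g) k n ≡ ∑[ n₁ + n₂ ≡ n ] ∑[ a , b ∈ exponentPairs k ] (moment f a n₁ * moment g b n₂)
  moment-⊛ {f} {g} f-triangular g-triangular k n = begin
    ∑[ i ≤ n ] (sgn i * (+ (i ℕ.^ k) * (f ⊛ g) i n))
      ≡⟨ ∑≤-cong n (λ i →
           trans (cong (sgn i *_) (*-distribˡ-∑∑ (+ (i ℕ.^ k)) (antidiagonal i) (antidiagonal n) F))
                 (*-distribˡ-∑∑ (sgn i) (antidiagonal i) (antidiagonal n) _)) ⟩
    ∑[ i ≤ n ] ∑[ i₁ + i₂ ≡ i ] ∑[ n₁ + n₂ ≡ n ] signedPower k i (f i₁ n₁ * g i₂ n₂)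
      ≡⟨ ∑≤-cong n (λ i → ∑anti-cong i (λ i₁ i₂ i₁+i₂≡i → ∑anti-cong n (λ n₁ n₂ _ →
           trans (cong (λ i → signedPower k i _) (sym i₁+i₂≡i)) (signedPower-+ k i₁ i₂ _ _)))) ⟩
    ∑[ i ≤ n ] ∑[ i₁ + i₂ ≡ i ] ∑[ n₁ + n₂ ≡ n ] ∑[ a , b ∈ E ] X a b i₁ i₂ n₁ n₂
      ≡⟨ ∑≤-cong n (λ i → ∑-comm (antidiagonal i) (antidiagonal n) _) ⟩
    ∑[ i ≤ n ] ∑[ n₁ + n₂ ≡ n ] ∑[ i₁ + i₂ ≡ i ] ∑[ a , b ∈ E ] X a b i₁ i₂ n₁ n₂
      ≡⟨ ∑≤-cong n (λ i → ∑-cong (antidiagonal n) (λ _ → ∑-comm (antidiagonal i) E _)) ⟩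
    ∑[ i ≤ n ] ∑[ n₁ + n₂ ≡ n ] ∑[ a , b ∈ E ] ∑[ i₁ + i₂ ≡ i ] X a b i₁ i₂ n₁ n₂
      ≡⟨ ∑≤-∑-comm n (antidiagonal n) _ ⟩
    ∑[ n₁ + n₂ ≡ n ] ∑[ i ≤ n ] ∑[ a , b ∈ E ] ∑[ i₁ + i₂ ≡ i ] X a b i₁ i₂ n₁ n₂
      ≡⟨ ∑-cong (antidiagonal n) (λ _ → ∑≤-∑-comm n E _) ⟩
    ∑[ n₁ + n₂ ≡ n ] ∑[ a , b ∈ E ] ∑[ i ≤ n ] ∑[ i₁ + i₂ ≡ i ] X a b i₁ i₂ n₁ n₂
      ≡⟨ ∑anti-cong n (λ n₁ n₂ n₁+n₂≡n → ∑-cong E (λ (a , b) → begin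
           ∑[ i ≤ n ] ∑[ i₁ + i₂ ≡ i ] X a b i₁ i₂ n₁ n₂
             ≡⟨ cong (λ m → ∑[ i ≤ m ] ∑[ i₁ + i₂ ≡ i ] X a b i₁ i₂ n₁ n₂) (sym n₁+n₂≡n) ⟩
           ∑[ i ≤ n₁ ℕ.+ n₂ ] ∑[ i₁ + i₂ ≡ i ] X a b i₁ i₂ n₁ n₂
             ≡⟨ ∑≤-cauchy n₁ n₂ (λ i → signedPower a i (f i n₁)) (λ i → signedPower b i (g i n₂))
                  (λ i n₁<i → signedPower-zero a i (f-triangular n₁<i))
                  (λ i n₂<i → signedPower-zero b i (g-triangular n₂<i)) ⟩
           moment f a n₁ * moment g b n₂
             ∎)) ⟩
    ∑[ n₁ + n₂ ≡ n ] ∑[ a , b ∈ E ] (moment f a n₁ * moment g b n₂)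
      ∎
    where
    open ≡-Reasoning
    E : List (ℕ × ℕ)
    E = exponentPairs k
    F : ℕ × ℕ → ℕ × ℕ → ℤ
    F (i₁ , i₂) (n₁ , n₂) = f i₁ n₁ * g i₂ n₂
    X : ℕ → ℕ → ℕ → ℕ → ℕ → ℕ → ℤ
    X a b i₁ i₂ n₁ n₂ = signedPower a i₁ (f i₁ n₁) * signedPower b i₂ (g i₂ n₂)
    signedPower-zero : ∀ a i {x} → x ≡ + 0 → signedPower a i x ≡ + 0
    signedPower-zero a i refl = trans (cong (sgn i *_) (ℤ.*-zeroʳ (+ (i ℕ.^ a)))) (ℤ.*-zeroʳ (sgn i))

  Alternating : (ℕ → ℕ → ℤ) → Set
  Alternating f = ∀ k n → + 0 ≤ sgn n * moment f k n

  sgn-moment-⊛ : ∀ {f g} → Triangular f → Triangular g → ∀ k n →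
    sgn n * moment (f ⊛ g) k n ≡
    ∑[ n₁ + n₂ ≡ n ] ∑[ a , b ∈ exponentPairs k ] (sgn n₁ * moment f a n₁ * (sgn n₂ * moment g b n₂))
  sgn-moment-⊛ {f} {g} f-triangular g-triangular k n = begin
    sgn n * moment (f ⊛ g) k n
      ≡⟨ cong (sgn n *_) (moment-⊛ f-triangular g-triangular k n) ⟩
    sgn n * ∑[ n₁ + n₂ ≡ n ] ∑[ a , b ∈ E ] (moment f a n₁ * moment g b n₂)
      ≡⟨ *-distribˡ-∑∑ (sgn n) (antidiagonal n) E _ ⟩
    ∑[ n₁ + n₂ ≡ n ] ∑[ a , b ∈ E ] (sgn n * (moment f a n₁ * moment g b n₂))
      ≡⟨ ∑anti-cong n (λ n₁ n₂ n₁+n₂≡n → ∑-cong E (λ (a , b) → begin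
           sgn n * (moment f a n₁ * moment g b n₂)
             ≡⟨ cong (λ m → sgn m * (moment f a n₁ * moment g b n₂)) (sym n₁+n₂≡n) ⟩
           sgn (n₁ ℕ.+ n₂) * (moment f a n₁ * moment g b n₂)
             ≡⟨ cong (_* (moment f a n₁ * moment g b n₂)) (sgn-+ n₁ n₂) ⟩
           sgn n₁ * sgn n₂ * (moment f a n₁ * moment g b n₂)
             ≡⟨ interchange (sgn n₁) (sgn n₂) _ _ ⟩
           sgn n₁ * moment f a n₁ * (sgn n₂ * moment g b n₂)
             ∎)) ⟩
    ∑[ n₁ + n₂ ≡ n ] ∑[ a , b ∈ E ] (sgn n₁ * moment f a n₁ * (sgn n₂ * moment g b n₂))
      ∎
    where
    open ≡-Reasoning
    open import Algebra.Properties.CommutativeSemigroup ℤ.*-commutativeSemigroup using (interchange)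
    E : List (ℕ × ℕ)
    E = exponentPairs k

  ∑-nonNegative : {X : Set} (xs : List X) {f : X → ℤ} → (∀ x → + 0 ≤ f x) → + 0 ≤ ∑ xs f
  ∑-nonNegative []       _   = ℤ.≤-refl
  ∑-nonNegative (x ∷ xs) 0≤f = ℤ.+-mono-≤ (0≤f x) (∑-nonNegative xs 0≤f)

  *-nonNegative : ∀ {x y} → + 0 ≤ x → + 0 ≤ y → + 0 ≤ x * y
  *-nonNegative {y = y} 0≤x 0≤y = ℤ.*-monoʳ-≤-nonNeg y ⦃ nonNegative 0≤y ⦄ 0≤x

  alternating-⊛ : ∀ {f g} → Triangular f → Triangular g → Alternating f → Alternating g → Alternating (f ⊛ g)
  alternating-⊛ f-triangular g-triangular f-alternating g-alternating k n =
    subst (+ 0 ≤_) (sym (sgn-moment-⊛ f-triangular g-triangular k n))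
      (∑-nonNegative (antidiagonal n) λ (n₁ , n₂) → ∑-nonNegative (exponentPairs k) λ (a , b) →
        *-nonNegative (f-alternating a n₁) (g-alternating b n₂))

open import Data.Integer using (+_; _*_; _≤_)
import Data.Integer.Properties as ℤ
open import Relation.Binary.PropositionalEquality using (sym; trans; cong; subst)
open Partitions using (c-∪; c-triangular)
open SignedMoments
open SemiringSums ℤ.+-*-commutativeSemiring using (_⊛_)

mainTheorem3 : (A₁ A₂ : Subset) → Disjoint A₁ A₂ →
    (∀ k n → + 0 ≤ sgn n * S A₁ k n) →
    (∀ k n → + 0 ≤ sgn n * S A₂ k n) →
    ∀ k n → + 0 ≤ sgn n * S (A₁ ∪ A₂) k n
mainTheorem3 A₁ A₂ disjoint h₁ h₂ k n =
  subst (λ s → + 0 ≤ sgn n * s) (sym S-∪)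
    (alternating-⊛ (pos-c-triangular A₁) (pos-c-triangular A₂) (alternating A₁ h₁) (alternating A₂ h₂) k n)
  where
  pos-c-triangular : ∀ A → Triangular (pos₂ (c A))
  pos-c-triangular A n<i = cong +_ (c-triangular A n<i)
  alternating : ∀ A → (∀ k n → + 0 ≤ sgn n * S A k n) → Alternating (pos₂ (c A))
  alternating A h k n = subst (λ s → + 0 ≤ sgn n * s) (S≡moment A k n) (h k n)
  S-∪ : S (A₁ ∪ A₂) k n ≡ moment (pos₂ (c A₁) ⊛ pos₂ (c A₂)) k n
  S-∪ = trans (S≡moment (A₁ ∪ A₂) k n)
          (moment-cong (λ i n → trans (cong +_ (c-∪ disjoint i n)) (pos-⊛ (c A₁) (c A₂) i n)) k n)
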